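{- For integers $n\ge 0$ and $q\ge 0$ define the associated Motzkin numbers $$m_n^{(q)}=n!\sum_{r=0}^{\lfloor n/2\rfloor}\frac{1}{(n-2r)!\,r!\,(r+q)!}.$$ Then for all integers $n\ge 1$ and $q\ge 0$, $$m_{n+1}^{(q)}=m_n^{(q)}+2\,n\,m_{n-1}^{(q+1)}.$$ -}

module Defs where

open import Data.Nat using (ℕ; suc; _∸_; _!)
import Data.Nat as ℕ
open import Data.Nat.Properties using (_!≢0)
open import Data.Integer using (+_)
open import Data.Rational using (ℚ; _/_; 0ℚ; _+_; _*_)
open import Data.List using (List; upTo; map; foldr)

sumℚ : List ℚ → ℚ
sumℚ = foldr _+_ 0ℚ

inv! : ℕ → ℚ
inv! k = _/_ (+ 1) (k !) {{k !≢0}}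

fact : ℕ → ℚ
fact k = (+ (k !)) / 1

term : ℕ → ℕ → ℕ → ℚ
term n q r = inv! (n ∸ 2 ℕ.* r) * (inv! r * inv! (r ℕ.+ q))

-- associated Motzkin number  m_n^{(q)} = n! * Σ_{r=0}^{⌊n/2⌋} 1/((n-2r)! r! (r+q)!)
-- (upTo k = [0, …, k-1], so upTo (⌊n/2⌋ + 1) ranges over r = 0..⌊n/2⌋)
motzkin : ℕ → ℕ → ℚ
motzkin n q = fact n * sumℚ (map (term n q) (upTo (suc (n ℕ./ 2))))

-- Let T n q r = n! / ((n - 2r)! r! (r + q)!) be the r-th summand of m_n^(q).  Splitting the
-- factor n + 1 of (n + 1)! as (n + 1 - 2r) + 2r gives the termwise recurrence
--   T (n+1) q (r+1) = T n q (r+1) + 2n T (n-1) (q+1) r,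
-- and T (n+1) q 0 = T n q 0 = 1/q!.  Once T is extended by zero outside 2r ≤ n the
-- recurrence holds for every r, so summing it over one common range gives the theorem
-- without distinguishing the parities of n.
module Submission where

open import Defs
open import Data.Nat using (ℕ; suc; _≥_)
open import Data.Integer using (+_)
open import Data.Rational using (_/_; _+_; _*_)
open import Relation.Binary.PropositionalEquality using (_≡_)

open import Algebra.Bundles using (CommutativeMonoid)
open import Data.List using (_∷_; map; applyUpTo)
open import Data.Nat as ℕ using (zero; _≤_; _<_; _≤?_; NonZero; z≤n; s≤s)
open import Data.Nat.DivMod using (m*n/n≡m; m/n*n≤m; m/n≤m; /-monoˡ-≤)
import Data.Nat.Properties as ℕ
import Data.Integer as ℤ
import Data.Integer.Properties as ℤ
open import Data.Product using (_,_)
open import Data.Rational using (ℚ; 0ℚ; 1ℚ; toℚᵘ)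
open import Data.Rational.Properties
  using (toℚᵘ-injective; toℚᵘ-fromℚᵘ; toℚᵘ-homo-+; toℚᵘ-homo-*; +-0-commutativeMonoid;
         +-assoc; +-identityˡ; +-identityʳ; *-assoc; *-comm; *-identityˡ; *-identityʳ; *-zeroʳ; *-distribˡ-+)
open import Data.Rational.Solver using (module +-*-Solver)
import Data.Rational.Unnormalised as ℚᵘ
import Data.Rational.Unnormalised.Properties as ℚᵘ
open import Function using (_∘_)
open import Relation.Binary using (Tri; tri<; tri≈; tri>)
open import Relation.Binary.PropositionalEquality using (refl; sym; trans; cong; cong₂; module ≡-Reasoning)
open import Relation.Nullary using (yes; no; contradiction)

open import Algebra.Properties.CommutativeSemigroup
  (CommutativeMonoid.commutativeSemigroup +-0-commutativeMonoid) using (interchange)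
open +-*-Solver using (solve; _:+_; _:*_; _:=_)

fromℕ : ℕ → ℚ
fromℕ n = + n / 1

toℚᵘ-fromℕ : ∀ n → toℚᵘ (fromℕ n) ℚᵘ.≃ ℚᵘ.mkℚᵘ (+ n) 0
toℚᵘ-fromℕ n = toℚᵘ-fromℚᵘ (ℚᵘ.mkℚᵘ (+ n) 0)

fromℕ-+ : ∀ m n → fromℕ (m ℕ.+ n) ≡ fromℕ m + fromℕ n
fromℕ-+ m n = toℚᵘ-injective (begin
  toℚᵘ (fromℕ (m ℕ.+ n))                ≈⟨ toℚᵘ-fromℕ (m ℕ.+ n) ⟩
  ℚᵘ.mkℚᵘ (+ (m ℕ.+ n)) 0               ≈⟨ ℚᵘ.*≡* (cong (ℤ._* + 1) integral) ⟩
  ℚᵘ.mkℚᵘ (+ m) 0 ℚᵘ.+ ℚᵘ.mkℚᵘ (+ n) 0   ≈⟨ ℚᵘ.+-cong (toℚᵘ-fromℕ m) (toℚᵘ-fromℕ n) ⟨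
  toℚᵘ (fromℕ m) ℚᵘ.+ toℚᵘ (fromℕ n)    ≈⟨ toℚᵘ-homo-+ (fromℕ m) (fromℕ n) ⟨
  toℚᵘ (fromℕ m + fromℕ n)              ∎)
  where
  open ℚᵘ.≃-Reasoning
  integral : + (m ℕ.+ n) ≡ + m ℤ.* + 1 ℤ.+ + n ℤ.* + 1
  integral = trans (ℤ.pos-+ m n) (sym (cong₂ ℤ._+_ (ℤ.*-identityʳ (+ m)) (ℤ.*-identityʳ (+ n))))

fromℕ-* : ∀ m n → fromℕ (m ℕ.* n) ≡ fromℕ m * fromℕ n
fromℕ-* m n = toℚᵘ-injective (begin
  toℚᵘ (fromℕ (m ℕ.* n))                ≈⟨ toℚᵘ-fromℕ (m ℕ.* n) ⟩
  ℚᵘ.mkℚᵘ (+ (m ℕ.* n)) 0               ≈⟨ ℚᵘ.*≡* (cong (ℤ._* + 1) (ℤ.pos-* m n)) ⟩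
  ℚᵘ.mkℚᵘ (+ m) 0 ℚᵘ.* ℚᵘ.mkℚᵘ (+ n) 0   ≈⟨ ℚᵘ.*-cong (toℚᵘ-fromℕ m) (toℚᵘ-fromℕ n) ⟨
  toℚᵘ (fromℕ m) ℚᵘ.* toℚᵘ (fromℕ n)    ≈⟨ toℚᵘ-homo-* (fromℕ m) (fromℕ n) ⟨
  toℚᵘ (fromℕ m * fromℕ n)              ∎)
  where open ℚᵘ.≃-Reasoning

*-inverse-fromℕ : ∀ m .{{_ : NonZero m}} → + 1 / m * fromℕ m ≡ 1ℚ
*-inverse-fromℕ m@(suc m-1) = toℚᵘ-injective (begin
  toℚᵘ (+ 1 / m * fromℕ m)                     ≈⟨ toℚᵘ-homo-* (+ 1 / m) (fromℕ m) ⟩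
  toℚᵘ (+ 1 / m) ℚᵘ.* toℚᵘ (fromℕ m)           ≈⟨ ℚᵘ.*-cong (toℚᵘ-fromℚᵘ (ℚᵘ.mkℚᵘ (+ 1) m-1)) (toℚᵘ-fromℕ m) ⟩
  ℚᵘ.1/ ℚᵘ.mkℚᵘ (+ m) 0 ℚᵘ.* ℚᵘ.mkℚᵘ (+ m) 0   ≈⟨ ℚᵘ.*-inverseˡ (ℚᵘ.mkℚᵘ (+ m) 0) ⟩
  toℚᵘ 1ℚ                                      ∎)
  where open ℚᵘ.≃-Reasoning

fact-suc : ∀ m → fact (suc m) ≡ fromℕ (suc m) * fact m
fact-suc m = fromℕ-* (suc m) (m ℕ.!)

inv!*fact : ∀ m → inv! m * fact m ≡ 1ℚ
inv!*fact m = *-inverse-fromℕ (m ℕ.!) {{m ℕ.!≢0}}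

inv!-suc : ∀ m → inv! m ≡ fromℕ (suc m) * inv! (suc m)
inv!-suc m = begin
  inv! m                                             ≡⟨ *-identityʳ (inv! m) ⟨
  inv! m * 1ℚ                                        ≡⟨ cong (inv! m *_) (inv!*fact (suc m)) ⟨
  inv! m * (inv! (suc m) * fact (suc m))             ≡⟨ cong (λ f → inv! m * (inv! (suc m) * f)) (fact-suc m) ⟩
  inv! m * (inv! (suc m) * (fromℕ (suc m) * fact m))  ≡⟨ rearrange (inv! m) (inv! (suc m)) (fromℕ (suc m)) (fact m) ⟩
  (fromℕ (suc m) * inv! (suc m)) * (inv! m * fact m) ≡⟨ cong (fromℕ (suc m) * inv! (suc m) *_) (inv!*fact m) ⟩
  (fromℕ (suc m) * inv! (suc m)) * 1ℚ                ≡⟨ *-identityʳ _ ⟩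
  fromℕ (suc m) * inv! (suc m)                       ∎
  where
  open ≡-Reasoning
  rearrange : ∀ a b c d → a * (b * (c * d)) ≡ (c * b) * (a * d)
  rearrange = solve 4 (λ a b c d → a :* (b :* (c :* d)) := (c :* b) :* (a :* d)) refl

map-applyUpTo : ∀ {A B : Set} (f : A → B) (g : ℕ → A) n → map f (applyUpTo g n) ≡ applyUpTo (f ∘ g) n
map-applyUpTo f g zero    = refl
map-applyUpTo f g (suc n) = cong (f (g 0) ∷_) (map-applyUpTo f (g ∘ suc) n)

sumUpTo : (ℕ → ℚ) → ℕ → ℚ
sumUpTo f n = sumℚ (applyUpTo f n)

sumUpTo-cong : ∀ {f g : ℕ → ℚ} n → (∀ {i} → i < n → f i ≡ g i) → sumUpTo f n ≡ sumUpTo g n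
sumUpTo-cong zero    f≗g = refl
sumUpTo-cong (suc n) f≗g = cong₂ _+_ (f≗g (s≤s z≤n)) (sumUpTo-cong n (f≗g ∘ s≤s))

sumUpTo-+ : ∀ (f g : ℕ → ℚ) n → sumUpTo (λ i → f i + g i) n ≡ sumUpTo f n + sumUpTo g n
sumUpTo-+ f g zero    = sym (+-identityʳ 0ℚ)
sumUpTo-+ f g (suc n) = trans (cong (λ t → f 0 + g 0 + t) (sumUpTo-+ (f ∘ suc) (g ∘ suc) n))
                              (interchange (f 0) (g 0) _ _)

*-distribˡ-sumUpTo : ∀ c (f : ℕ → ℚ) n → c * sumUpTo f n ≡ sumUpTo (λ i → c * f i) n
*-distribˡ-sumUpTo c f zero    = *-zeroʳ c
*-distribˡ-sumUpTo c f (suc n) = trans (*-distribˡ-+ c (f 0) _)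
                                       (cong (λ t → c * f 0 + t) (*-distribˡ-sumUpTo c (f ∘ suc) n))

sumUpTo-zeroTail : ∀ {f : ℕ → ℚ} {m n} → m ≤ n → (∀ {i} → m ≤ i → f i ≡ 0ℚ) → sumUpTo f n ≡ sumUpTo f m
sumUpTo-zeroTail {n = zero}  z≤n       vanish = refl
sumUpTo-zeroTail {n = suc n} z≤n       vanish =
  trans (cong₂ _+_ (vanish z≤n) (sumUpTo-zeroTail {n = n} z≤n (λ _ → vanish z≤n))) (+-identityˡ 0ℚ)
sumUpTo-zeroTail {f}         (s≤s m≤n) vanish =
  cong (λ t → f 0 + t) (sumUpTo-zeroTail {f ∘ suc} m≤n (vanish ∘ s≤s))

2*m≤n⇒m≤n/2 : ∀ {m n} → 2 ℕ.* m ≤ n → m ≤ n ℕ./ 2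
2*m≤n⇒m≤n/2 {m} {n} 2m≤n = begin
  m              ≡⟨ m*n/n≡m m 2 ⟨
  m ℕ.* 2 ℕ./ 2  ≤⟨ /-monoˡ-≤ 2 (ℕ.≤-trans (ℕ.≤-reflexive (ℕ.*-comm m 2)) 2m≤n) ⟩
  n ℕ./ 2        ∎
  where open ℕ.≤-Reasoning

m≤n/2⇒2*m≤n : ∀ {m n} → m ≤ n ℕ./ 2 → 2 ℕ.* m ≤ n
m≤n/2⇒2*m≤n {m} {n} m≤n/2 = begin
  2 ℕ.* m          ≤⟨ ℕ.*-monoʳ-≤ 2 m≤n/2 ⟩
  2 ℕ.* (n ℕ./ 2)  ≡⟨ ℕ.*-comm 2 (n ℕ./ 2) ⟩
  n ℕ./ 2 ℕ.* 2    ≤⟨ m/n*n≤m n 2 ⟩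
  n                ∎
  where open ℕ.≤-Reasoning

-- Zero when 2r > n, where the truncated subtraction in term would give a spurious nonzero value.
motzkinTerm : ℕ → ℕ → ℕ → ℚ
motzkinTerm n q r with 2 ℕ.* r ≤? n
... | yes _ = fact n * term n q r
... | no  _ = 0ℚ

motzkinTerm-≤ : ∀ n q r → 2 ℕ.* r ≤ n → motzkinTerm n q r ≡ fact n * term n q r
motzkinTerm-≤ n q r 2r≤n with 2 ℕ.* r ≤? n
... | yes _    = refl
... | no 2r≰n = contradiction 2r≤n 2r≰n

motzkinTerm-> : ∀ n q r → n < 2 ℕ.* r → motzkinTerm n q r ≡ 0ℚ
motzkinTerm-> n q r n<2r with 2 ℕ.* r ≤? n
... | yes 2r≤n = contradiction 2r≤n (ℕ.<⇒≱ n<2r)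
... | no _     = refl

motzkinTerm-≡ : ∀ {n} q r a → 2 ℕ.* r ℕ.+ a ≡ n →
  motzkinTerm n q r ≡ fact n * (inv! a * (inv! r * inv! (r ℕ.+ q)))
motzkinTerm-≡ q r a refl =
  trans (motzkinTerm-≤ _ q r (ℕ.m≤m+n (2 ℕ.* r) a))
        (cong (λ b → fact (2 ℕ.* r ℕ.+ a) * (inv! b * (inv! r * inv! (r ℕ.+ q))))
              (ℕ.m+n∸m≡n (2 ℕ.* r) a))

motzkinTerm-zero : ∀ n q → motzkinTerm n q 0 ≡ inv! q
motzkinTerm-zero n q = begin
  motzkinTerm n q 0               ≡⟨ motzkinTerm-≡ q 0 n refl ⟩
  fact n * (inv! n * (1ℚ * inv! q)) ≡⟨ cong (λ x → fact n * (inv! n * x)) (*-identityˡ (inv! q)) ⟩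
  fact n * (inv! n * inv! q)      ≡⟨ *-assoc (fact n) (inv! n) (inv! q) ⟨
  (fact n * inv! n) * inv! q      ≡⟨ cong (_* inv! q) (trans (*-comm (fact n) (inv! n)) (inv!*fact n)) ⟩
  1ℚ * inv! q                     ≡⟨ *-identityˡ (inv! q) ⟩
  inv! q                          ∎
  where open ≡-Reasoning

motzkin≡sumUpTo : ∀ n q {L} → n ℕ./ 2 < L → motzkin n q ≡ sumUpTo (motzkinTerm n q) L
motzkin≡sumUpTo n q {L} n/2<L = begin
  motzkin n q
    ≡⟨ cong (λ xs → fact n * sumℚ xs) (map-applyUpTo (term n q) (λ r → r) B) ⟩
  fact n * sumUpTo (term n q) B
    ≡⟨ *-distribˡ-sumUpTo (fact n) (term n q) B ⟩
  sumUpTo (λ r → fact n * term n q r) B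
    ≡⟨ sumUpTo-cong B (λ {r} r<B → motzkinTerm-≤ n q r (m≤n/2⇒2*m≤n (ℕ.≤-pred r<B))) ⟨
  sumUpTo (motzkinTerm n q) B
    ≡⟨ sumUpTo-zeroTail n/2<L (λ {r} n/2<r → motzkinTerm-> n q r (ℕ.≰⇒> (ℕ.<⇒≱ n/2<r ∘ 2*m≤n⇒m≤n/2))) ⟨
  sumUpTo (motzkinTerm n q) L
    ∎
  where
  open ≡-Reasoning
  B = suc (n ℕ./ 2)

fromℕ*fact-suc : ∀ m k → fromℕ m * fact (suc k) ≡ fromℕ (m ℕ.* suc k) * fact k
fromℕ*fact-suc m k = begin
  fromℕ m * fact (suc k)                ≡⟨ cong (fromℕ m *_) (fact-suc k) ⟩
  fromℕ m * (fromℕ (suc k) * fact k)    ≡⟨ *-assoc (fromℕ m) (fromℕ (suc k)) (fact k) ⟨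
  (fromℕ m * fromℕ (suc k)) * fact k    ≡⟨ cong (_* fact k) (fromℕ-* m (suc k)) ⟨
  fromℕ (m ℕ.* suc k) * fact k          ∎
  where open ≡-Reasoning

factorial-pascal : ∀ k s a x → 2 ℕ.* suc s ℕ.+ a ≡ suc k →
  fact (suc (suc k)) * (inv! (suc a) * (inv! (suc s) * x))
    ≡ fact (suc k) * (inv! a * (inv! (suc s) * x))
      + fromℕ (2 ℕ.* suc k) * (fact k * (inv! (suc a) * (inv! s * x)))
factorial-pascal k s a x 2r+a≡n = begin
  fact (suc n) * (A * (R * x))
    ≡⟨ cong (_* (A * (R * x))) (fact-suc n) ⟩
  (fromℕ (suc n) * fact n) * (A * (R * x))
    ≡⟨ cong (λ c → (c * fact n) * (A * (R * x))) split ⟩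
  ((fromℕ (suc a) + fromℕ 2 * fromℕ (suc s)) * fact n) * (A * (R * x))
    ≡⟨ distribute (fromℕ (suc a)) (fromℕ (suc s)) (fromℕ 2) (fact n) A R x ⟩
  fact n * ((fromℕ (suc a) * A) * (R * x)) + (fromℕ 2 * fact n) * (A * ((fromℕ (suc s) * R) * x))
    ≡⟨ cong₂ (λ u v → fact n * (u * (R * x)) + (fromℕ 2 * fact n) * (A * (v * x))) (inv!-suc a) (inv!-suc s) ⟨
  fact n * (inv! a * (R * x)) + (fromℕ 2 * fact n) * (A * (inv! s * x))
    ≡⟨ cong (λ c → fact n * (inv! a * (R * x)) + c) (trans (cong (_* (A * (inv! s * x))) (fromℕ*fact-suc 2 k))
                                                           (*-assoc (fromℕ (2 ℕ.* n)) (fact k) (A * (inv! s * x)))) ⟩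
  fact n * (inv! a * (R * x)) + fromℕ (2 ℕ.* n) * (fact k * (A * (inv! s * x)))
    ∎
  where
  open ≡-Reasoning
  n = suc k
  A = inv! (suc a)
  R = inv! (suc s)
  split : fromℕ (suc n) ≡ fromℕ (suc a) + fromℕ 2 * fromℕ (suc s)
  split = begin
    fromℕ (suc n)                          ≡⟨ cong (fromℕ ∘ suc) (trans (sym 2r+a≡n) (ℕ.+-comm (2 ℕ.* suc s) a)) ⟩
    fromℕ (suc a ℕ.+ 2 ℕ.* suc s)          ≡⟨ fromℕ-+ (suc a) (2 ℕ.* suc s) ⟩
    fromℕ (suc a) + fromℕ (2 ℕ.* suc s)    ≡⟨ cong (λ t → fromℕ (suc a) + t) (fromℕ-* 2 (suc s)) ⟩
    fromℕ (suc a) + fromℕ 2 * fromℕ (suc s) ∎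
  distribute : ∀ α β t f y z w →
    ((α + t * β) * f) * (y * (z * w)) ≡ f * ((α * y) * (z * w)) + (t * f) * (y * ((β * z) * w))
  distribute = solve 7 (λ α β t f y z w →
    ((α :+ t :* β) :* f) :* (y :* (z :* w)) := f :* ((α :* y) :* (z :* w)) :+ (t :* f) :* (y :* ((β :* z) :* w)))
    refl

factorial-pascal-boundary : ∀ k s x → 2 ℕ.* suc s ≡ suc (suc k) →
  fact (suc (suc k)) * (inv! (suc s) * x) ≡ fromℕ (2 ℕ.* suc k) * (fact k * (inv! s * x))
factorial-pascal-boundary k s x 2r≡n+1 = begin
  fact (suc n) * (R * x)                           ≡⟨ cong (_* (R * x)) (fact-suc n) ⟩
  (fromℕ (suc n) * fact n) * (R * x)               ≡⟨ cong (λ c → (c * fact n) * (R * x)) split ⟩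
  ((fromℕ 2 * fromℕ (suc s)) * fact n) * (R * x)   ≡⟨ rearrange (fromℕ 2) (fromℕ (suc s)) (fact n) R x ⟩
  (fromℕ 2 * fact n) * ((fromℕ (suc s) * R) * x)   ≡⟨ cong₂ (λ c v → c * (v * x)) (fromℕ*fact-suc 2 k) (sym (inv!-suc s)) ⟩
  (fromℕ (2 ℕ.* n) * fact k) * (inv! s * x)        ≡⟨ *-assoc (fromℕ (2 ℕ.* n)) (fact k) (inv! s * x) ⟩
  fromℕ (2 ℕ.* n) * (fact k * (inv! s * x))        ∎
  where
  open ≡-Reasoning
  n = suc k
  R = inv! (suc s)
  split : fromℕ (suc n) ≡ fromℕ 2 * fromℕ (suc s)
  split = trans (cong fromℕ (sym 2r≡n+1)) (fromℕ-* 2 (suc s))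
  rearrange : ∀ t β f z w → ((t * β) * f) * (z * w) ≡ (t * f) * ((β * z) * w)
  rearrange = solve 5 (λ t β f z w → ((t :* β) :* f) :* (z :* w) := (t :* f) :* ((β :* z) :* w)) refl

motzkinTerm-step : ∀ k q s →
  motzkinTerm (suc (suc k)) q (suc s)
    ≡ motzkinTerm (suc k) q (suc s) + fromℕ (2 ℕ.* suc k) * motzkinTerm k (suc q) s
motzkinTerm-step k q s = by-position (ℕ.<-cmp (2 ℕ.* suc s) (suc (suc k)))
  where
  open ≡-Reasoning
  c = fromℕ (2 ℕ.* suc k)
  I = inv! (suc s ℕ.+ q)

  2[1+s]+a≡2+[2s+a] : ∀ a → 2 ℕ.* suc s ℕ.+ a ≡ suc (suc (2 ℕ.* s ℕ.+ a))
  2[1+s]+a≡2+[2s+a] a = cong (ℕ._+ a) (ℕ.*-suc 2 s)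

  shifted : ∀ a → 2 ℕ.* s ℕ.+ a ≡ k → motzkinTerm k (suc q) s ≡ fact k * (inv! a * (inv! s * I))
  shifted a 2s+a≡k = trans (motzkinTerm-≡ (suc q) s a 2s+a≡k)
                           (cong (λ j → fact k * (inv! a * (inv! s * inv! j))) (ℕ.+-suc s q))

  by-position : Tri (2 ℕ.* suc s < suc (suc k)) (2 ℕ.* suc s ≡ suc (suc k)) (suc (suc k) < 2 ℕ.* suc s) →
    motzkinTerm (suc (suc k)) q (suc s) ≡ motzkinTerm (suc k) q (suc s) + c * motzkinTerm k (suc q) s
  by-position (tri< 2r<n+1 _ _) with ℕ.m≤n⇒∃[o]m+o≡n (ℕ.≤-pred 2r<n+1)
  ... | a , 2r+a≡n = begin
    motzkinTerm (suc (suc k)) q (suc s)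
      ≡⟨ motzkinTerm-≡ q (suc s) (suc a) (trans (ℕ.+-suc (2 ℕ.* suc s) a) (cong suc 2r+a≡n)) ⟩
    fact (suc (suc k)) * (inv! (suc a) * (inv! (suc s) * I))
      ≡⟨ factorial-pascal k s a I 2r+a≡n ⟩
    fact (suc k) * (inv! a * (inv! (suc s) * I)) + c * (fact k * (inv! (suc a) * (inv! s * I)))
      ≡⟨ cong₂ (λ u v → u + c * v) (motzkinTerm-≡ q (suc s) a 2r+a≡n) (shifted (suc a) 2s+[1+a]≡k) ⟨
    motzkinTerm (suc k) q (suc s) + c * motzkinTerm k (suc q) s
      ∎
    where
    2s+[1+a]≡k : 2 ℕ.* s ℕ.+ suc a ≡ k
    2s+[1+a]≡k = trans (ℕ.+-suc (2 ℕ.* s) a) (ℕ.suc-injective (trans (sym (2[1+s]+a≡2+[2s+a] a)) 2r+a≡n))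
  by-position (tri≈ _ 2r≡n+1 _) = begin
    motzkinTerm (suc (suc k)) q (suc s)
      ≡⟨ motzkinTerm-≡ q (suc s) 0 2r+0≡n+1 ⟩
    fact (suc (suc k)) * (1ℚ * (inv! (suc s) * I))
      ≡⟨ cong (fact (suc (suc k)) *_) (*-identityˡ (inv! (suc s) * I)) ⟩
    fact (suc (suc k)) * (inv! (suc s) * I)
      ≡⟨ factorial-pascal-boundary k s I 2r≡n+1 ⟩
    c * (fact k * (inv! s * I))
      ≡⟨ cong (λ v → c * (fact k * v)) (*-identityˡ (inv! s * I)) ⟨
    c * (fact k * (1ℚ * (inv! s * I)))
      ≡⟨ +-identityˡ _ ⟨
    0ℚ + c * (fact k * (1ℚ * (inv! s * I)))
      ≡⟨ cong₂ (λ u v → u + c * v) (motzkinTerm-> (suc k) q (suc s) (ℕ.≤-reflexive (sym 2r≡n+1))) (shifted 0 2s+0≡k) ⟨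
    motzkinTerm (suc k) q (suc s) + c * motzkinTerm k (suc q) s
      ∎
    where
    2r+0≡n+1 : 2 ℕ.* suc s ℕ.+ 0 ≡ suc (suc k)
    2r+0≡n+1 = trans (ℕ.+-identityʳ (2 ℕ.* suc s)) 2r≡n+1
    2s+0≡k : 2 ℕ.* s ℕ.+ 0 ≡ k
    2s+0≡k = ℕ.suc-injective (ℕ.suc-injective (trans (sym (2[1+s]+a≡2+[2s+a] 0)) 2r+0≡n+1))
  by-position (tri> _ _ n+1<2r) = begin
    motzkinTerm (suc (suc k)) q (suc s)                           ≡⟨ motzkinTerm-> (suc (suc k)) q (suc s) n+1<2r ⟩
    0ℚ                                                            ≡⟨ trans (+-identityˡ (c * 0ℚ)) (*-zeroʳ c) ⟨
    0ℚ + c * 0ℚ                                                   ≡⟨ cong₂ (λ u v → u + c * v) n-vanishes n-1-vanishes ⟨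
    motzkinTerm (suc k) q (suc s) + c * motzkinTerm k (suc q) s   ∎
    where
    n-vanishes : motzkinTerm (suc k) q (suc s) ≡ 0ℚ
    n-vanishes = motzkinTerm-> (suc k) q (suc s) (ℕ.<-trans (ℕ.n<1+n (suc k)) n+1<2r)
    n-1-vanishes : motzkinTerm k (suc q) s ≡ 0ℚ
    n-1-vanishes = motzkinTerm-> k (suc q) s
      (ℕ.≤-pred (ℕ.≤-pred (ℕ.≤-trans n+1<2r (ℕ.≤-reflexive (ℕ.*-suc 2 s)))))

mainTheorem3 : (n q : ℕ) → n ≥ 1 →
    motzkin (suc n) q ≡ motzkin n q + ((+ (2 Data.Nat.* n)) / 1) * motzkin (n Data.Nat.∸ 1) (suc q)
mainTheorem3 zero      q ()
mainTheorem3 n@(suc k) q _ = begin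
  motzkin (suc n) q
    ≡⟨ motzkin≡sumUpTo (suc n) q (half< (suc n) ℕ.≤-refl) ⟩
  T₊ 0 + sumUpTo (T₊ ∘ suc) (suc n)
    ≡⟨ cong₂ _+_ (trans (motzkinTerm-zero (suc n) q) (sym (motzkinTerm-zero n q)))
                 (sumUpTo-cong (suc n) (λ {s} _ → motzkinTerm-step k q s)) ⟩
  T 0 + sumUpTo (λ s → T (suc s) + c * T₋ s) (suc n)
    ≡⟨ cong (λ t → T 0 + t) (trans (sumUpTo-+ (T ∘ suc) (λ s → c * T₋ s) (suc n))
                                   (cong (λ t → sumUpTo (T ∘ suc) (suc n) + t) (sym (*-distribˡ-sumUpTo c T₋ (suc n))))) ⟩
  T 0 + (sumUpTo (T ∘ suc) (suc n) + c * sumUpTo T₋ (suc n))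
    ≡⟨ +-assoc (T 0) _ _ ⟨
  sumUpTo T (suc (suc n)) + c * sumUpTo T₋ (suc n)
    ≡⟨ cong₂ (λ u v → u + c * v) (motzkin≡sumUpTo n q (half< n (ℕ.n≤1+n n)))
                                 (motzkin≡sumUpTo k (suc q) (half< k (ℕ.n≤1+n k))) ⟨
  motzkin n q + c * motzkin k (suc q)
    ∎
  where
  open ≡-Reasoning
  c  = fromℕ (2 ℕ.* n)
  T₊ = motzkinTerm (suc n) q
  T  = motzkinTerm n q
  T₋ = motzkinTerm k (suc q)
  half< : ∀ m {L} → m ≤ L → m ℕ./ 2 < suc L
  half< m m≤L = s≤s (ℕ.≤-trans (m/n≤m m 2) m≤L)
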